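{- Let $q\neq 1$ be real and define $F_n(x,s,q)$ by $F_0(x,s,q)=0$, $F_1(x,s,q)=1$ and $F_n(x,s,q)=xF_{n-1}(x,s,q)+q^{n-2}sF_{n-2}(x,s,q)$ for $n\ge 2$. Then for all integers $m,n\ge1$, $$F_{m+n}(x,s,q)=F_m(x,q^ns,q)F_{n+1}(x,s,q)+q^ns\,F_{m-1}(x,q^{n+1}s,q)F_n(x,s,q).$$
   Context: Substitutions such as $F_m(x,q^ns,q)$ replace the variable $s$ by $q^ns$. -}

module Defs where

open import Level using (Level)
open import Data.Nat using (ℕ; zero; suc)
open import Algebra.Bundles using (CommutativeRing)

module _ {c ℓ : Level} (R : CommutativeRing c ℓ) where
  open CommutativeRing R

  pow : Carrier → ℕ → Carrier
  pow q zero = 1#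
  pow q (suc n) = q * pow q n

  F : ℕ → Carrier → Carrier → Carrier → Carrier
  F zero x s q = 0#
  F (suc zero) x s q = 1#
  F (suc (suc n)) x s q = x * F (suc n) x s q + (pow q n * s) * F n x s q

-- For fixed n, both sides of the identity satisfy, as sequences in m, the
-- recurrence G_{m+2} = x G_{m+1} + q^m (q^n s) G_m: the left side because
-- q^{m+n} s = q^m (q^n s), the right side because it is a constant linear
-- combination of F_m(x, q^n s, q) and of the companion sequence
-- (q^n s) F_{m-1}(x, q^{n+1} s, q), which satisfies the same recurrence once
-- its value at m = 0 is taken to be 1. Both sides agree at m = 0 and m = 1,
-- so they agree everywhere.
module Submission where

open import Defs
open import Level using (Level)
open import Data.Nat using (ℕ; zero; suc; _≤_; _∸_) renaming (_+_ to _+ℕ_)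
open import Data.Product using (_×_; _,_; proj₁)
open import Relation.Nullary using (¬_)
open import Algebra.Bundles using (CommutativeRing)
import Algebra.Solver.Ring.NaturalCoefficients.Default as NatCoefficientSolver
import Relation.Binary.Reasoning.Setoid as SetoidReasoning

module _ {r ℓ : Level} (R : CommutativeRing r ℓ) where
  open CommutativeRing R
  open NatCoefficientSolver commutativeSemiring using (solve; _:=_; _:+_; _:*_)
  open SetoidReasoning setoid

  pow-+ : ∀ q m n → pow R q (m +ℕ n) ≈ pow R q m * pow R q n
  pow-+ q zero    n = sym (*-identityˡ _)
  pow-+ q (suc m) n = trans (*-congˡ (pow-+ q m n)) (sym (*-assoc _ _ _))

  module _ (x q : Carrier) where

    Recurrent : Carrier → (ℕ → Carrier) → Set ℓ
    Recurrent t a = ∀ m → a (suc (suc m)) ≈ x * a (suc m) + (pow R q m * t) * a m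

    recurrent-unique : ∀ {t a b} → Recurrent t a → Recurrent t b →
                       a 0 ≈ b 0 → a 1 ≈ b 1 → ∀ m → a m ≈ b m
    recurrent-unique {t} {a} {b} rec-a rec-b a₀≈b₀ a₁≈b₁ m = proj₁ (agree m)
      where
      agree : ∀ m → a m ≈ b m × a (suc m) ≈ b (suc m)
      agree zero    = a₀≈b₀ , a₁≈b₁
      agree (suc m) with agree m
      ... | aₘ≈bₘ , aₘ₊₁≈bₘ₊₁ = aₘ₊₁≈bₘ₊₁ , (begin
        a (suc (suc m))                             ≈⟨ rec-a m ⟩
        x * a (suc m) + (pow R q m * t) * a m       ≈⟨ +-cong (*-congˡ aₘ₊₁≈bₘ₊₁) (*-congˡ aₘ≈bₘ) ⟩
        x * b (suc m) + (pow R q m * t) * b m       ≈⟨ rec-b m ⟨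
        b (suc (suc m))                             ∎)

    recurrent-combination : ∀ {t a b} u v → Recurrent t a → Recurrent t b →
                            Recurrent t (λ m → a m * u + b m * v)
    recurrent-combination {t} {a} {b} u v rec-a rec-b m = begin
      a (suc (suc m)) * u + b (suc (suc m)) * v
        ≈⟨ +-cong (*-congʳ (rec-a m)) (*-congʳ (rec-b m)) ⟩
      (x * a (suc m) + c * a m) * u + (x * b (suc m) + c * b m) * v
        ≈⟨ regroup x c (a m) (a (suc m)) (b m) (b (suc m)) u v ⟩
      x * (a (suc m) * u + b (suc m) * v) + c * (a m * u + b m * v) ∎
      where
      c : Carrier
      c = pow R q m * t
      regroup : ∀ x c a₀ a₁ b₀ b₁ u v →
                (x * a₁ + c * a₀) * u + (x * b₁ + c * b₀) * v
                  ≈ x * (a₁ * u + b₁ * v) + c * (a₀ * u + b₀ * v)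
      regroup = solve 8 (λ x c a₀ a₁ b₀ b₁ u v →
        (x :* a₁ :+ c :* a₀) :* u :+ (x :* b₁ :+ c :* b₀) :* v
          := x :* (a₁ :* u :+ b₁ :* v) :+ c :* (a₀ :* u :+ b₀ :* v)) refl

    F-recurrent : ∀ t → Recurrent t (λ m → F R m x t q)
    F-recurrent t m = refl

    F-+-recurrent : ∀ s n → Recurrent (pow R q n * s) (λ m → F R (m +ℕ n) x s q)
    F-+-recurrent s n m =
      +-congˡ (*-congʳ (trans (*-congʳ (pow-+ q m n)) (*-assoc _ _ _)))

    -- At m = 0 the recurrence forces the value 1, not the 0 that m ∸ 1 would give.
    companion : Carrier → ℕ → ℕ → Carrier
    companion s n zero    = 1#
    companion s n (suc m) = (pow R q n * s) * F R m x (pow R q (suc n) * s) q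

    companion-recurrent : ∀ s n → Recurrent (pow R q n * s) (companion s n)
    companion-recurrent s n zero = begin
      t * 1#                                 ≈⟨ *-identityʳ t ⟩
      t                                      ≈⟨ *-identityˡ t ⟨
      1# * t                                 ≈⟨ *-identityʳ _ ⟨
      (1# * t) * 1#                          ≈⟨ +-identityˡ _ ⟨
      0# + (1# * t) * 1#                     ≈⟨ +-congʳ (trans (*-congˡ (zeroʳ t)) (zeroʳ x)) ⟨
      x * (t * 0#) + (1# * t) * 1#           ∎
      where
      t : Carrier
      t = pow R q n * s
    companion-recurrent s n (suc m) =
      regroup x q (pow R q m) (pow R q n) s
              (F R (suc m) x (pow R q (suc n) * s) q) (F R m x (pow R q (suc n) * s) q)
      where
      regroup : ∀ x q p r s a₁ a₀ →
                (r * s) * (x * a₁ + (p * ((q * r) * s)) * a₀)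
                  ≈ x * ((r * s) * a₁) + ((q * p) * (r * s)) * ((r * s) * a₀)
      regroup = solve 7 (λ x q p r s a₁ a₀ →
        (r :* s) :* (x :* a₁ :+ (p :* ((q :* r) :* s)) :* a₀)
          := x :* ((r :* s) :* a₁) :+ ((q :* p) :* (r :* s)) :* ((r :* s) :* a₀)) refl

    F-addition : ∀ s n m →
      F R (m +ℕ n) x s q
        ≈ F R m x (pow R q n * s) q * F R (suc n) x s q + companion s n m * F R n x s q
    F-addition s n = recurrent-unique
      (F-+-recurrent s n)
      (recurrent-combination u v (F-recurrent (pow R q n * s)) (companion-recurrent s n))
      (sym (trans (+-cong (zeroˡ u) (*-identityˡ v)) (+-identityˡ v)))
      (sym (trans (+-cong (*-identityˡ u) (trans (*-congʳ (zeroʳ _)) (zeroˡ v))) (+-identityʳ u)))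
      where
      u v : Carrier
      u = F R (suc n) x s q
      v = F R n x s q

mainTheorem4 : {c ℓ : Level} (R : CommutativeRing c ℓ) →
    let open CommutativeRing R in
    (x s q : Carrier) → ¬ (q ≈ 1#) → (m n : ℕ) → 1 ≤ m → 1 ≤ n →
      F R (m +ℕ n) x s q
        ≈ F R m x (pow R q n * s) q * F R (suc n) x s q
          + ((pow R q n * s) * F R (m ∸ 1) x (pow R q (suc n) * s) q) * F R n x s q
mainTheorem4 R x s q _ (suc m) n _ _ = F-addition R x q s n (suc m)
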